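{- For a complete multipartite graph $G$ with $\lambda\ge 2$, \[ \mathrm{nim}(\mathrm{GEN}(G))=\begin{cases} 2\,\mathrm{pty}(\sigma), & \mathrm{pty}(\lambda)=0 \\ \mathrm{pty}(\sigma), & \mathrm{pty}(\lambda)=1. \end{cases} \]
   Context: $G=K_{m_1,\ldots,m_k}$ is a complete multipartite graph with $k\ge 2$ parts and $m_1\le\cdots\le m_k$; $\sigma:=|\{i\mid m_i=1\}|$ and $\lambda:=|\{i\mid m_i\ge 2\}|$ are the numbers of one-vertex parts and of parts with at least two vertices. For a graph $G=(V,E)$, a set of vertices is geodetically convex if it contains every vertex on every shortest path between two of its vertices; the convex hull $[P]$ is the smallest convex set containing $P$, and $P$ is generating if $[P]=V$. In the achievement game $\mathrm{GEN}(G)$, two players alternately select previously-unselected vertices; the game ends as soon as the selected set generates, and the last player to move wins. $\mathrm{nim}$ denotes the nim-number of an impartial game, and $\mathrm{pty}(k):=k\bmod 2$. -}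

module Defs where

open import Data.Nat using (ℕ; zero; suc; _≤_; _<_)
open import Data.Fin using (Fin)
open import Data.Fin.Properties using (_≟_)
open import Data.Fin.Subset using (Subset; _∈_; _∉_; _⊆_; _∪_; ⁅_⁆)
open import Data.List using (List; []; _∷_; length; filter; allFin)
import Data.List.Membership.Propositional as LM
open import Data.Product using (Σ; _×_)
open import Relation.Nullary using (¬_; Dec; yes; no)
open import Relation.Binary.PropositionalEquality using (_≡_; _≢_)
open import Data.Nat.Properties using (_≤?_)
import Data.Nat as N

module _ {n : ℕ} (E : Fin n → Fin n → Set) where

  -- IsWalk u v xs : the list of vertices xs is a walk from u to v
  -- (consecutive vertices adjacent).  Its length (number of edges)
  -- is  length xs - 1.
  data IsWalk : Fin n → Fin n → List (Fin n) → Set where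
    here : ∀ {u} → IsWalk u u (u ∷ [])
    step : ∀ {u w v xs} → E u w → IsWalk w v xs → IsWalk u v (u ∷ xs)

  IsShortest : Fin n → Fin n → List (Fin n) → Set
  IsShortest u v xs =
    IsWalk u v xs × (∀ ys → IsWalk u v ys → length xs ≤ length ys)

  Convex : Subset n → Set
  Convex S = ∀ u v xs → u ∈ S → v ∈ S → IsShortest u v xs →
             ∀ w → w LM.∈ xs → w ∈ S

  _∈Hull_ : Fin n → Subset n → Set
  w ∈Hull P = ∀ (S : Subset n) → Convex S → P ⊆ S → w ∈ S

  Generating : Subset n → Set
  Generating P = ∀ w → w ∈Hull P

  -- Achievement game GEN(G): positions are the sets of selected vertices;
  -- from a non-generating position P a move selects some v ∉ P.
  -- A generating position has no moves (game over; last mover wins).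
  -- NimGEN P g : the nim-number (Sprague–Grundy value, mex of the values
  -- of the options) of the position P is g.
  data NimGEN : Subset n → ℕ → Set where
    mk : ∀ {P g} →
         (∀ v → ¬ Generating P → v ∉ P →
            Σ ℕ (λ h → NimGEN (⁅ v ⁆ ∪ P) h × h ≢ g)) →
         (∀ h → h < g →
            ¬ Generating P × Σ (Fin n) (λ v → v ∉ P × NimGEN (⁅ v ⁆ ∪ P) h)) →
         NimGEN P g

-- Complete multipartite graphs, given by a part-assignment
-- p : Fin n → Fin k (each part nonempty); u ~ v iff p u ≠ p v.

module _ {n k : ℕ} (p : Fin n → Fin k) where

  MultipartiteAdj : Fin n → Fin n → Set
  MultipartiteAdj u v = p u ≢ p v

  partSize : Fin k → ℕ
  partSize i = length (filter (λ v → p v ≟ i) (allFin n))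

  sigma : ℕ
  sigma = length (filter (λ i → partSize i N.≟ 1) (allFin k))

  lambda : ℕ
  lambda = length (filter (λ i → 2 ≤? partSize i) (allFin k))

{-# OPTIONS --safe #-}
module Submission where

-- A set containing two vertices u ≠ w of one part is generating: u – x – w is a shortest
-- path for every x outside that part, and two vertices of another part with at least two
-- vertices (there is one since λ ≥ 2) pull the first part in as well.  A transversal
-- (at most one vertex per part) is a clique, hence convex.  So until the game ends the
-- selected set is a transversal, and a move either selects a second vertex of a touched
-- part, which ends the game, or touches a new part.  The nim-number of a transversal
-- therefore only depends on whether it touches a part with at least two vertices and on
-- the parities of the numbers s and b of untouched parts with one and with at least two
-- vertices: it is 1 + pty(s + b) once a big part is touched (selecting a free vertex of
-- it ends the game), and pty(s) or 2 pty(s) according as b is odd or even before that.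
-- The empty set has s = σ and b = λ.

open import Defs
open import Data.Bool using (Bool; true; false)
open import Data.Fin using (Fin)
open import Data.Fin.Properties using (_≟_; any?)
open import Data.Fin.Subset using (Subset; ⊥; _∈_; _∉_; _∪_; ⁅_⁆; _⊃_)
open import Data.Fin.Subset.Induction using (⊃-wellFounded)
open import Data.Fin.Subset.Properties
  using (_∈?_; ∉⊥; q⊆p∪q; x∈p∪q⁺; x∈p∪q⁻; x∈⁅x⁆; x∈⁅y⁆⇒x≡y)
open import Data.List using ([]; _∷_; length; filter; allFin)
open import Data.List.Membership.Propositional using (lose) renaming (_∈_ to _∈ₗ_)
open import Data.List.Membership.Propositional.Properties using (∈-filter⁺; ∈-allFin)
open import Data.List.Properties using (filter-some)
open import Data.List.Relation.Unary.All as All using ([]; _∷_)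
open import Data.List.Relation.Unary.All.Properties using (all-filter)
open import Data.List.Relation.Unary.AllPairs using (_∷_)
open import Data.List.Relation.Unary.Any using (here; there)
open import Data.List.Relation.Unary.Unique.Propositional using (Unique)
open import Data.List.Relation.Unary.Unique.Propositional.Properties as Unique using (allFin⁺)
import Data.Nat as ℕ
open import Data.Nat using (ℕ; zero; suc; _≤_; _<_; _*_; _%_; z≤n; s≤s; parity)
open import Data.Nat.Properties using (≤-trans; _≤?_; suc-injective)
open import Data.Parity using (Parity; 0ℙ; 1ℙ; _⁻¹) renaming (_+_ to _+ℙ_)
open import Data.Parity.Properties using (suc-homo-⁻¹; ⁻¹-involutive)
open import Data.Product as Product using (Σ; _×_; _,_; proj₁; ∃; ∃₂; ∃-syntax)
open import Data.Sum as Sum using (_⊎_; inj₁; inj₂)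
open import Function using (id; _∘_; _⇔_; Equivalence; mk⇔)
import Induction.WellFounded as WF
open import Level using (0ℓ)
open import Relation.Binary.PropositionalEquality
  using (_≡_; _≢_; refl; sym; trans; cong; cong₂; subst; ≢-sym; module ≡-Reasoning)
open import Relation.Nullary using (¬_; contradiction; yes; no)
open import Relation.Nullary.Decidable using (_×-dec_; ¬?)
open import Relation.Unary using (Pred; Decidable)

open ≡-Reasoning

toℕ : Parity → ℕ
toℕ 0ℙ = 0
toℕ 1ℙ = 1

%2≡toℕ∘parity : ∀ n → n % 2 ≡ toℕ (parity n)
%2≡toℕ∘parity 0             = refl
%2≡toℕ∘parity 1             = refl
%2≡toℕ∘parity (suc (suc n)) = %2≡toℕ∘parity n

toℕ-injective : ∀ {p q} → toℕ p ≡ toℕ q → p ≡ q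
toℕ-injective {0ℙ} {0ℙ} _ = refl
toℕ-injective {1ℙ} {1ℙ} _ = refl

parity-from-%2 : ∀ n {q} → n % 2 ≡ toℕ q → parity n ≡ q
parity-from-%2 n n%2≡q = toℕ-injective (trans (sym (%2≡toℕ∘parity n)) n%2≡q)

parity-suc : ∀ n → parity (suc n) ≡ parity n ⁻¹
parity-suc n = trans (sym (⁻¹-involutive (parity (suc n)))) (cong _⁻¹ (suc-homo-⁻¹ n))

parity≡1ℙ⇒suc : ∀ {n} → parity n ≡ 1ℙ → ∃[ m ] n ≡ suc m × parity m ≡ 0ℙ
parity≡1ℙ⇒suc {zero}  ()
parity≡1ℙ⇒suc {suc m} eq = m , refl , trans (sym (suc-homo-⁻¹ m)) (cong _⁻¹ eq)

parity≡0ℙ⇒suc : ∀ {n} → 1 ≤ n → parity n ≡ 0ℙ → ∃[ m ] n ≡ suc m × parity m ≡ 1ℙ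
parity≡0ℙ⇒suc {suc m} _ eq = m , refl , trans (sym (suc-homo-⁻¹ m)) (cong _⁻¹ eq)

-- A state (t , s , b) abstracts a transversal position: t records whether it touches a
-- part with at least two vertices ("touched" value for t = true, "fresh" for t = false),
-- s and b count the untouched parts with one and with at least two vertices.

valueℙ : Bool → Parity → Parity → ℕ
valueℙ true  ps pb = suc (toℕ (ps +ℙ pb))
valueℙ false ps 0ℙ = 2 * toℕ ps
valueℙ false ps 1ℙ = toℕ ps

value : Bool → ℕ → ℕ → ℕ
value t s b = valueℙ t (parity s) (parity b)

data Option (t : Bool) (s b h : ℕ) : Set where
  finishing  : t ≡ true → h ≡ 0 → Option t s b h
  takeSingle : ∀ {s′} → s ≡ suc s′ → h ≡ value t s′ b → Option t s b h
  takeBig    : ∀ {b′} → b ≡ suc b′ → h ≡ value true s b′ → Option t s b h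

valueℙ-flip-single : ∀ t ps pb → valueℙ t ps pb ≢ valueℙ t (ps ⁻¹) pb
valueℙ-flip-single true  0ℙ 0ℙ ()
valueℙ-flip-single true  0ℙ 1ℙ ()
valueℙ-flip-single true  1ℙ 0ℙ ()
valueℙ-flip-single true  1ℙ 1ℙ ()
valueℙ-flip-single false 0ℙ 0ℙ ()
valueℙ-flip-single false 0ℙ 1ℙ ()
valueℙ-flip-single false 1ℙ 0ℙ ()
valueℙ-flip-single false 1ℙ 1ℙ ()

valueℙ-take-big : ∀ t ps pb → valueℙ true ps pb ≢ valueℙ t ps (pb ⁻¹)
valueℙ-take-big true  0ℙ 0ℙ ()
valueℙ-take-big true  0ℙ 1ℙ ()
valueℙ-take-big true  1ℙ 0ℙ ()
valueℙ-take-big true  1ℙ 1ℙ ()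
valueℙ-take-big false 0ℙ 0ℙ ()
valueℙ-take-big false 0ℙ 1ℙ ()
valueℙ-take-big false 1ℙ 0ℙ ()
valueℙ-take-big false 1ℙ 1ℙ ()

option≢value : ∀ {t s b h} → Option t s b h → h ≢ value t s b
option≢value (finishing refl refl) ()
option≢value {t} {b = b} (takeSingle {s′} refl refl) rewrite parity-suc s′ =
  valueℙ-flip-single t (parity s′) (parity b)
option≢value {t} {s} (takeBig {b′} refl refl) rewrite parity-suc b′ =
  valueℙ-take-big t (parity s) (parity b′)

below-touched-value⇒option : ∀ {s b h} → h < value true s b → Option true s b h
below-touched-value⇒option {h = zero} _ = finishing refl refl
below-touched-value⇒option {s} {b} {suc h} h<v with parity s in ps | parity b in pb
below-touched-value⇒option {s} {h = suc zero} _ | 1ℙ | 0ℙ with parity≡1ℙ⇒suc {s} ps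
... | s′ , refl , ps′ = takeSingle refl (sym (cong₂ (valueℙ true) ps′ pb))
below-touched-value⇒option {b = b} {h = suc zero} _ | 0ℙ | 1ℙ with parity≡1ℙ⇒suc {b} pb
... | b′ , refl , pb′ = takeBig refl (sym (cong₂ (valueℙ true) ps pb′))
below-touched-value⇒option {h = suc zero}    (s≤s ()) | 0ℙ | 0ℙ
below-touched-value⇒option {h = suc zero}    (s≤s ()) | 1ℙ | 1ℙ
below-touched-value⇒option {h = suc (suc h)} (s≤s ()) | 0ℙ | 0ℙ
below-touched-value⇒option {h = suc (suc h)} (s≤s (s≤s ())) | 0ℙ | 1ℙ
below-touched-value⇒option {h = suc (suc h)} (s≤s (s≤s ())) | 1ℙ | 0ℙ
below-touched-value⇒option {h = suc (suc h)} (s≤s ()) | 1ℙ | 1ℙ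

below-fresh-value⇒option : ∀ {s b h} → 1 ≤ b → h < value false s b → Option false s b h
below-fresh-value⇒option {s} {b} {h} 1≤b h<v with parity s in ps | parity b in pb
... | 0ℙ | 0ℙ = contradiction h<v λ ()
... | 0ℙ | 1ℙ = contradiction h<v λ ()
... | 1ℙ | q with parity≡1ℙ⇒suc {s} ps
...   | s′ , refl , ps′ with h | q
...     | zero | 0ℙ = takeSingle refl (sym (cong₂ (valueℙ false) ps′ pb))
...     | zero | 1ℙ = takeSingle refl (sym (cong₂ (valueℙ false) ps′ pb))
...     | suc zero | 0ℙ with parity≡0ℙ⇒suc 1≤b pb
...       | b′ , refl , pb′ = takeBig refl (sym (cong₂ (valueℙ true) ps pb′))
below-fresh-value⇒option _ (s≤s ())       | 1ℙ | _ | _ , refl , _ | suc zero    | 1ℙ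
below-fresh-value⇒option _ (s≤s (s≤s ())) | 1ℙ | _ | _ , refl , _ | suc (suc _) | 0ℙ
below-fresh-value⇒option _ (s≤s ())       | 1ℙ | _ | _ , refl , _ | suc (suc _) | 1ℙ

value-fresh-even : ∀ s b → b % 2 ≡ 0 → value false s b ≡ 2 * (s % 2)
value-fresh-even s b b%2≡0 = begin
  value false s b      ≡⟨ cong (valueℙ false (parity s)) (parity-from-%2 b b%2≡0) ⟩
  2 * toℕ (parity s)   ≡⟨ cong (2 *_) (%2≡toℕ∘parity s) ⟨
  2 * (s % 2)          ∎

value-fresh-odd : ∀ s b → b % 2 ≡ 1 → value false s b ≡ s % 2
value-fresh-odd s b b%2≡1 = begin
  value false s b      ≡⟨ cong (valueℙ false (parity s)) (parity-from-%2 b b%2≡1) ⟩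
  toℕ (parity s)       ≡⟨ %2≡toℕ∘parity s ⟨
  s % 2                ∎

module _ {a p} {A : Set a} {P : Pred A p} (P? : Decidable P) where

  filter-witness : ∀ xs → 0 < length (filter P? xs) → ∃ P
  filter-witness xs pos with filter P? xs | all-filter P? xs
  ... | x ∷ _ | Px ∷ _ = x , Px

  filter-two-witnesses : ∀ {xs} → Unique xs → 1 < length (filter P? xs) →
                         ∃₂ λ x y → x ≢ y × P x × P y
  filter-two-witnesses {xs} u gt with filter P? xs | all-filter P? xs | Unique.filter⁺ P? u
  ... | x ∷ y ∷ _ | Px ∷ Py ∷ _ | (x≢y ∷ _) ∷ _ = x , y , x≢y , Px , Py
  ... | _ ∷ []    | _           | _             = contradiction gt λ { (s≤s ()) }

  filter-one-witness : ∀ {xs x y} → length (filter P? xs) ≡ 1 →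
                       x ∈ₗ xs → y ∈ₗ xs → P x → P y → x ≡ y
  filter-one-witness {xs} len x∈ y∈ Px Py
    with filter P? xs | ∈-filter⁺ P? x∈ Px | ∈-filter⁺ P? y∈ Py
  ... | _ ∷ [] | here refl | here refl = refl

module _ {a p q} {A : Set a} {P : Pred A p} {Q : Pred A q}
         (P? : Decidable P) (Q? : Decidable Q) where

  length-filter-cong : ∀ xs → (∀ {x} → x ∈ₗ xs → P x ⇔ Q x) →
                       length (filter P? xs) ≡ length (filter Q? xs)
  length-filter-cong []       _   = refl
  length-filter-cong (x ∷ xs) P⇔Q with P? x | Q? x | length-filter-cong xs (P⇔Q ∘ there)
  ... | yes _  | yes _  | eq = cong suc eq
  ... | no  _  | no  _  | eq = eq
  ... | yes Px | no ¬Qx | _  = contradiction (Equivalence.to (P⇔Q (here refl)) Px) ¬Qx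
  ... | no ¬Px | yes Qx | _  = contradiction (Equivalence.from (P⇔Q (here refl)) Qx) ¬Px

  length-filter-remove : ∀ {x xs} → Unique xs → x ∈ₗ xs → P x → ¬ Q x →
                         (∀ {y} → y ≢ x → P y ⇔ Q y) →
                         length (filter P? xs) ≡ suc (length (filter Q? xs))
  length-filter-remove {xs = y ∷ ys} (y∉ys ∷ u) (here refl) Px ¬Qx P⇔Q
    with P? y | Q? y
  ... | no ¬Px | _      = contradiction Px ¬Px
  ... | yes _  | yes Qx = contradiction Qx ¬Qx
  ... | yes _  | no _   = cong suc (length-filter-cong ys (λ z∈ → P⇔Q (≢-sym (All.lookup y∉ys z∈))))
  length-filter-remove {xs = y ∷ ys} (y∉ys ∷ u) (there x∈) Px ¬Qx P⇔Q
    with P? y | Q? y | length-filter-remove u x∈ Px ¬Qx P⇔Q | P⇔Q (All.lookup y∉ys x∈)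
  ... | yes _  | yes _  | eq | _     = cong suc eq
  ... | no  _  | no  _  | eq | _     = eq
  ... | yes Py | no ¬Qy | _  | Py⇔Qy = contradiction (Equivalence.to Py⇔Qy Py) ¬Qy
  ... | no ¬Py | yes Qy | _  | Py⇔Qy = contradiction (Equivalence.from Py⇔Qy Qy) ¬Py

insert⊃ : ∀ {n} {P : Subset n} {v} → v ∉ P → (⁅ v ⁆ ∪ P) ⊃ P
insert⊃ {P = P} {v} v∉P = q⊆p∪q ⁅ v ⁆ P , v , x∈p∪q⁺ (inj₁ (x∈⁅x⁆ v)) , v∉P

∈-insert⁻ : ∀ {n} {P : Subset n} {u v} → u ∈ ⁅ v ⁆ ∪ P → u ≡ v ⊎ u ∈ P
∈-insert⁻ {P = P} {v = v} u∈ = Sum.map₁ (x∈⁅y⁆⇒x≡y v) (x∈p∪q⁻ ⁅ v ⁆ P u∈)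

module _ {n} {E : Fin n → Fin n → Set} where

  generating⇒nim0 : ∀ {P} → Generating E P → NimGEN E P 0
  generating⇒nim0 gen = mk (λ _ ¬gen _ → contradiction gen ¬gen) (λ _ ())

  convex-missing⇒¬generating : ∀ {S v} → Convex E S → v ∉ S → ¬ Generating E S
  convex-missing⇒¬generating {S} {v} cS v∉S gen = v∉S (gen v S cS id)

  short-walk-endpoints : ∀ {u v xs} → IsWalk E u v xs → length xs ≤ 2 →
                         ∀ {w} → w ∈ₗ xs → w ≡ u ⊎ w ≡ v
  short-walk-endpoints here                         _              (here w≡u)         = inj₁ w≡u
  short-walk-endpoints (step _ here)                _              (here w≡u)         = inj₁ w≡u
  short-walk-endpoints (step _ here)                _              (there (here w≡v)) = inj₂ w≡v
  short-walk-endpoints (step _ (step _ here))       (s≤s (s≤s ())) _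
  short-walk-endpoints (step _ (step _ (step _ _))) (s≤s (s≤s ())) _

  pairwise-adjacent⇒convex : ∀ {S} → (∀ {u w} → u ∈ S → w ∈ S → u ≢ w → E u w) → Convex E S
  pairwise-adjacent⇒convex {S} adj u w xs u∈S w∈S (walk , shortest) y y∈xs
    with short-walk-endpoints walk short y∈xs
    where
    direct : ∃[ ys ] IsWalk E u w ys × length ys ≤ 2
    direct with u ≟ w
    ... | yes refl = _ , here , s≤s z≤n
    ... | no  u≢w  = _ , step (adj u∈S w∈S u≢w) here , s≤s (s≤s z≤n)
    short : length xs ≤ 2
    short = let ys , walk′ , |ys|≤2 = direct in ≤-trans (shortest ys walk′) |ys|≤2
  ... | inj₁ refl = u∈S
  ... | inj₂ refl = w∈S

module _ {n} (E : Fin n → Fin n → Set) {I : Set}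
         (Live : I → Subset n → Set) (val : I → Subset n → ℕ) where

  Certified : Subset n → ℕ → Set
  Certified P h = (Generating E P × h ≡ 0) ⊎ ∃[ t ] Live t P × h ≡ val t P

  nimGEN-certified :
    (∀ {t P v} → Live t P → v ∉ P → ∃[ h ] Certified (⁅ v ⁆ ∪ P) h × h ≢ val t P) →
    (∀ {t P h} → Live t P → h < val t P →
       ¬ Generating E P × ∃[ v ] v ∉ P × Certified (⁅ v ⁆ ∪ P) h) →
    ∀ {t P} → Live t P → NimGEN E P (val t P)
  nimGEN-certified avoid attain {P = P} = WF.All.wfRec ⊃-wellFounded _ NimLive nimLive P
    where
    NimLive : Subset n → Set
    NimLive P = ∀ {t} → Live t P → NimGEN E P (val t P)

    certified⇒nim : ∀ {P h} → NimLive P → Certified P h → NimGEN E P h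
    certified⇒nim _  (inj₁ (gen , refl))      = generating⇒nim0 gen
    certified⇒nim ih (inj₂ (_ , live , refl)) = ih live

    nimLive : ∀ P → WF.WfRec _⊃_ NimLive P → NimLive P
    nimLive P rec {t} live = mk options below
      where
      options : ∀ v → ¬ Generating E P → v ∉ P →
                ∃[ h ] NimGEN E (⁅ v ⁆ ∪ P) h × h ≢ val t P
      options v _ v∉P = let h , c , h≢ = avoid live v∉P in
                        h , certified⇒nim (rec (insert⊃ v∉P)) c , h≢
      below : ∀ h → h < val t P → ¬ Generating E P × ∃[ v ] v ∉ P × NimGEN E (⁅ v ⁆ ∪ P) h
      below h h< = let ¬gen , v , v∉P , c = attain live h< in
                   ¬gen , v , v∉P , certified⇒nim (rec (insert⊃ v∉P)) c

-- Complete multipartite graphs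

module _ {n k} (p : Fin n → Fin k) where

  private
    E : Fin n → Fin n → Set
    E = MultipartiteAdj p

  same-part-walk-length : ∀ {a c ys} → p a ≡ p c → a ≢ c → IsWalk E a c ys → 3 ≤ length ys
  same-part-walk-length _     a≢a  here                         = contradiction refl a≢a
  same-part-walk-length pa≡pc _    (step pa≢pc here)            = contradiction pa≡pc pa≢pc
  same-part-walk-length _     _    (step _ (step _ here))       = s≤s (s≤s (s≤s z≤n))
  same-part-walk-length _     _    (step _ (step _ (step _ _))) = s≤s (s≤s (s≤s z≤n))

  convex-⊇-other-parts : ∀ {S a c w} → Convex E S → a ∈ S → c ∈ S → a ≢ c → p a ≡ p c →
                         p w ≢ p a → w ∈ S
  convex-⊇-other-parts {S} {a} {c} {w} cS a∈S c∈S a≢c pa≡pc pw≢pa =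
    cS a c (a ∷ w ∷ c ∷ []) a∈S c∈S (path , λ _ → same-part-walk-length pa≡pc a≢c)
       w (there (here refl))
    where
    path : IsWalk E a c (a ∷ w ∷ c ∷ [])
    path = step (pw≢pa ∘ sym) (step (λ pw≡pc → pw≢pa (trans pw≡pc (sym pa≡pc))) here)

  Transversal : Subset n → Set
  Transversal P = ∀ {u w} → u ∈ P → w ∈ P → p u ≡ p w → u ≡ w

  transversal-convex : ∀ {P} → Transversal P → Convex E P
  transversal-convex tr = pairwise-adjacent⇒convex λ u∈ w∈ u≢w pu≡pw → u≢w (tr u∈ w∈ pu≡pw)

  Touched : Subset n → Pred (Fin k) 0ℓ
  Touched P i = ∃[ v ] v ∈ P × p v ≡ i

  touched? : ∀ P → Decidable (Touched P)
  touched? P i = any? λ v → v ∈? P ×-dec p v ≟ i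

  touched-insert⁺ : ∀ {P v i} → Touched P i → Touched (⁅ v ⁆ ∪ P) i
  touched-insert⁺ (u , u∈P , pu≡i) = u , x∈p∪q⁺ (inj₂ u∈P) , pu≡i

  touched-insert⁻ : ∀ {P v i} → Touched (⁅ v ⁆ ∪ P) i → p v ≡ i ⊎ Touched P i
  touched-insert⁻ (u , u∈ , pu≡i) with ∈-insert⁻ u∈
  ... | inj₁ refl = inj₁ pu≡i
  ... | inj₂ u∈P  = inj₂ (u , u∈P , pu≡i)

  untouched-insert : ∀ {P v i} → p v ≢ i → ¬ Touched P i → ¬ Touched (⁅ v ⁆ ∪ P) i
  untouched-insert pv≢i ¬τ = Sum.[ pv≢i , ¬τ ] ∘ touched-insert⁻

  transversal-insert : ∀ {P v} → Transversal P → ¬ Touched P (p v) → Transversal (⁅ v ⁆ ∪ P)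
  transversal-insert {v = v} tr ¬τ u∈ w∈ pu≡pw with ∈-insert⁻ u∈ | ∈-insert⁻ w∈
  ... | inj₁ refl | inj₁ refl = refl
  ... | inj₁ refl | inj₂ w∈P  = contradiction (_ , w∈P , sym pu≡pw) ¬τ
  ... | inj₂ u∈P  | inj₁ refl = contradiction (_ , u∈P , pu≡pw) ¬τ
  ... | inj₂ u∈P  | inj₂ w∈P  = tr u∈P w∈P pu≡pw

  untouched? : ∀ {ℓ} {C : Pred (Fin k) ℓ} → Decidable C →
               ∀ P → Decidable (λ i → C i × ¬ Touched P i)
  untouched? C? P i = C? i ×-dec ¬? (touched? P i)

  untouchedCount : ∀ {ℓ} {C : Pred (Fin k) ℓ} → Decidable C → Subset n → ℕ
  untouchedCount C? P = length (filter (untouched? C? P) (allFin k))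

  untouchedCount-all : ∀ {ℓ} {C : Pred (Fin k) ℓ} (C? : Decidable C) {P} →
                       (∀ {i} → C i → ¬ Touched P i) →
                       untouchedCount C? P ≡ length (filter C? (allFin k))
  untouchedCount-all C? {P} ¬τ =
    length-filter-cong (untouched? C? P) C? (allFin k) λ _ → mk⇔ proj₁ λ Ci → Ci , ¬τ Ci

  module _ {ℓ} {C : Pred (Fin k) ℓ} (C? : Decidable C) {P : Subset n} {v : Fin n} where

    untouched⇔ : ∀ {i} → p v ≢ i → (C i × ¬ Touched P i) ⇔ (C i × ¬ Touched (⁅ v ⁆ ∪ P) i)
    untouched⇔ pv≢i = mk⇔ (Product.map₂ (untouched-insert pv≢i))
                          (Product.map₂ (_∘ touched-insert⁺))

    untouchedCount-insert-∈ : C (p v) → ¬ Touched P (p v) →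
                              untouchedCount C? P ≡ suc (untouchedCount C? (⁅ v ⁆ ∪ P))
    untouchedCount-insert-∈ Cpv ¬τ =
      length-filter-remove (untouched? C? P) (untouched? C? (⁅ v ⁆ ∪ P))
        (allFin⁺ k) (∈-allFin (p v)) (Cpv , ¬τ)
        (λ (_ , ¬τ′) → ¬τ′ (v , x∈p∪q⁺ (inj₁ (x∈⁅x⁆ v)) , refl))
        (λ i≢pv → untouched⇔ (≢-sym i≢pv))

    untouchedCount-insert-∉ : ¬ C (p v) → untouchedCount C? P ≡ untouchedCount C? (⁅ v ⁆ ∪ P)
    untouchedCount-insert-∉ ¬Cpv =
      length-filter-cong (untouched? C? P) (untouched? C? (⁅ v ⁆ ∪ P)) (allFin k) λ _ →
      mk⇔ (λ (Ci , ¬τ) → Equivalence.to (untouched⇔ (pv≢ Ci)) (Ci , ¬τ))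
          (λ (Ci , ¬τ′) → Equivalence.from (untouched⇔ (pv≢ Ci)) (Ci , ¬τ′))
      where
      pv≢ : ∀ {i} → C i → p v ≢ i
      pv≢ Ci refl = ¬Cpv Ci

-- Transversal positions

module _ {n k} (p : Fin n → Fin k) (surj : ∀ i → ∃[ v ] p v ≡ i) (two-big : 2 ≤ lambda p) where

  private
    E : Fin n → Fin n → Set
    E = MultipartiteAdj p

  Single Big : Pred (Fin k) 0ℓ
  Single i = partSize p i ≡ 1
  Big    i = 2 ≤ partSize p i

  single? : Decidable Single
  single? i = partSize p i ℕ.≟ 1

  big? : Decidable Big
  big? i = 2 ≤? partSize p i

  partSize-pos : ∀ i → 0 < partSize p i
  partSize-pos i = let v , pv≡i = surj i in filter-some (λ v → p v ≟ i) (lose (∈-allFin v) pv≡i)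

  single⊎big : ∀ i → Single i ⊎ Big i
  single⊎big i with partSize p i | partSize-pos i
  ... | suc zero    | _ = inj₁ refl
  ... | suc (suc _) | _ = inj₂ (s≤s (s≤s z≤n))

  single-part-vertex-unique : ∀ {u w} → Single (p u) → p w ≡ p u → w ≡ u
  single-part-vertex-unique {u} {w} single pw≡pu =
    filter-one-witness (λ v → p v ≟ p u) single (∈-allFin w) (∈-allFin u) pw≡pu refl

  big-part-two-vertices : ∀ {i} → Big i → ∃₂ λ a c → a ≢ c × p a ≡ i × p c ≡ i
  big-part-two-vertices {i} = filter-two-witnesses (λ v → p v ≟ i) (allFin⁺ n)

  other-big-part : ∀ i → ∃[ j ] j ≢ i × Big j
  other-big-part i with filter-two-witnesses big? (allFin⁺ k) two-big
  ... | j , j′ , j≢j′ , big , big′ with j ≟ i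
  ...   | yes refl = j′ , ≢-sym j≢j′ , big′
  ...   | no  j≢i  = j , j≢i , big

  same-part⇒generating : ∀ {P u w} → u ∈ P → w ∈ P → u ≢ w → p u ≡ p w → Generating E P
  same-part⇒generating {P} {u} {w} u∈P w∈P u≢w pu≡pw x S cS P⊆S = pulled x
    where
    outside : ∀ {y} → p y ≢ p u → y ∈ S
    outside = convex-⊇-other-parts p cS (P⊆S u∈P) (P⊆S w∈P) u≢w pu≡pw
    pulled : ∀ y → y ∈ S
    pulled y with p y ≟ p u
    ... | no  py≢pu = outside py≢pu
    ... | yes py≡pu with other-big-part (p u)
    ...   | j , j≢pu , big with big-part-two-vertices big
    ...     | a , c , a≢c , pa≡j , pc≡j =
      convex-⊇-other-parts p cS (outside (off pa≡j)) (outside (off pc≡j)) a≢c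
        (trans pa≡j (sym pc≡j)) (λ py≡pa → off pa≡j (trans (sym py≡pa) py≡pu))
      where
      off : ∀ {z} → p z ≡ j → p z ≢ p u
      off pz≡j pz≡pu = j≢pu (trans (sym pz≡j) pz≡pu)

  untouchedSingles untouchedBigs : Subset n → ℕ
  untouchedSingles = untouchedCount p single?
  untouchedBigs    = untouchedCount p big?

  Live : Bool → Subset n → Set
  Live true  P = Transversal p P × ∃[ i ] Big i × Touched p P i
  Live false P = Transversal p P × (∀ {i} → Big i → ¬ Touched p P i)

  positionValue : Bool → Subset n → ℕ
  positionValue t P = value t (untouchedSingles P) (untouchedBigs P)

  LiveCertified : Subset n → ℕ → Set
  LiveCertified = Certified E Live positionValue

  live⇒transversal : ∀ {t P} → Live t P → Transversal p P
  live⇒transversal {true}  = proj₁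
  live⇒transversal {false} = proj₁

  live⇒¬generating : ∀ {t P v} → Live t P → v ∉ P → ¬ Generating E P
  live⇒¬generating live =
    convex-missing⇒¬generating (transversal-convex p (live⇒transversal live))

  shared-part-big : ∀ {P u v} → u ∈ P → v ∉ P → p u ≡ p v → Big (p v)
  shared-part-big u∈P v∉P pu≡pv with single⊎big (p _)
  ... | inj₁ single =
    contradiction (subst (_∈ _) (single-part-vertex-unique single pu≡pv) u∈P) v∉P
  ... | inj₂ big    = big

  single⇒¬big : ∀ {i} → Single i → ¬ Big i
  single⇒¬big single big with subst (2 ≤_) single big
  ... | s≤s ()

  live-insert : ∀ {t P v} → Live t P → ¬ Touched p P (p v) → ¬ Big (p v) → Live t (⁅ v ⁆ ∪ P)
  live-insert {true} (tr , i , big , τ) ¬τ _ =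
    transversal-insert p tr ¬τ , i , big , touched-insert⁺ p τ
  live-insert {false} {v = v} (tr , ¬τ-big) ¬τ ¬big = transversal-insert p tr ¬τ , λ big →
    Sum.[ (λ pv≡i → ¬big (subst Big (sym pv≡i) big)) , ¬τ-big big ] ∘ touched-insert⁻ p {v = v}

  live-insert-big : ∀ {t P v} → Live t P → ¬ Touched p P (p v) → Big (p v) →
                    Live true (⁅ v ⁆ ∪ P)
  live-insert-big {v = v} live ¬τ big = transversal-insert p (live⇒transversal live) ¬τ ,
                                         p v , big , v , x∈p∪q⁺ (inj₁ (x∈⁅x⁆ v)) , refl

  insert-single : ∀ {t P v} → Live t P → ¬ Touched p P (p v) → Single (p v) →
                  Live t (⁅ v ⁆ ∪ P) ×
                  untouchedSingles P ≡ suc (untouchedSingles (⁅ v ⁆ ∪ P)) ×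
                  untouchedBigs P ≡ untouchedBigs (⁅ v ⁆ ∪ P)
  insert-single live ¬τ single =
    live-insert live ¬τ (single⇒¬big single) ,
    untouchedCount-insert-∈ p single? single ¬τ ,
    untouchedCount-insert-∉ p big? (single⇒¬big single)

  insert-big : ∀ {t P v} → Live t P → ¬ Touched p P (p v) → Big (p v) →
               Live true (⁅ v ⁆ ∪ P) ×
               untouchedSingles P ≡ untouchedSingles (⁅ v ⁆ ∪ P) ×
               untouchedBigs P ≡ suc (untouchedBigs (⁅ v ⁆ ∪ P))
  insert-big live ¬τ big =
    live-insert-big live ¬τ big ,
    untouchedCount-insert-∉ p single? (λ single → single⇒¬big single big) ,
    untouchedCount-insert-∈ p big? big ¬τ

  insert-touched⇒generating : ∀ {P u v} → u ∈ P → v ∉ P → p u ≡ p v → Generating E (⁅ v ⁆ ∪ P)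
  insert-touched⇒generating {v = v} u∈P v∉P =
    same-part⇒generating (x∈p∪q⁺ (inj₂ u∈P)) (x∈p∪q⁺ (inj₁ (x∈⁅x⁆ v))) λ { refl → v∉P u∈P }

  transversal-free-vertex : ∀ {P i} → Transversal p P → Big i → ∃[ w ] w ∉ P × p w ≡ i
  transversal-free-vertex {P} tr big with big-part-two-vertices big
  ... | a , c , a≢c , pa≡i , pc≡i with a ∈? P | c ∈? P
  ...   | no  a∉P | _       = a , a∉P , pa≡i
  ...   | yes _   | no  c∉P = c , c∉P , pc≡i
  ...   | yes a∈P | yes c∈P = contradiction (tr a∈P c∈P (trans pa≡i (sym pc≡i))) a≢c

  touched-big⇒true : ∀ {t P i} → Live t P → Big i → Touched p P i → t ≡ true
  touched-big⇒true {true}  _             _   _ = refl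
  touched-big⇒true {false} (_ , ¬τ-big) big τ = contradiction τ (¬τ-big big)

  move-option : ∀ {t P v} → Live t P → v ∉ P →
                ∃[ h ] LiveCertified (⁅ v ⁆ ∪ P) h ×
                       Option t (untouchedSingles P) (untouchedBigs P) h
  move-option {t} {P} {v} live v∉P with touched? p P (p v)
  ... | yes τ@(u , u∈P , pu≡pv) =
    0 , inj₁ (insert-touched⇒generating u∈P v∉P pu≡pv , refl) ,
    finishing (touched-big⇒true live (shared-part-big u∈P v∉P pu≡pv) τ) refl
  ... | no ¬τ with single⊎big (p v)
  ...   | inj₁ single = let live′ , s≡ , b≡ = insert-single live ¬τ single in
    _ , inj₂ (t , live′ , refl) ,
    takeSingle s≡ (cong (value t (untouchedSingles (⁅ v ⁆ ∪ P))) (sym b≡))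
  ...   | inj₂ big    = let live′ , s≡ , b≡ = insert-big live ¬τ big in
    _ , inj₂ (true , live′ , refl) ,
    takeBig b≡ (cong (λ s → value true s (untouchedBigs (⁅ v ⁆ ∪ P))) (sym s≡))

  realise-option : ∀ {t P h} → Live t P → Option t (untouchedSingles P) (untouchedBigs P) h →
                   ∃[ v ] v ∉ P × LiveCertified (⁅ v ⁆ ∪ P) h
  realise-option {true} (tr , i , big , u , u∈P , pu≡i) (finishing _ refl) =
    let w , w∉P , pw≡i = transversal-free-vertex tr big in
    w , w∉P , inj₁ (insert-touched⇒generating u∈P w∉P (trans pu≡i (sym pw≡i)) , refl)
  realise-option {t} {P} live (takeSingle s≡ refl)
    with filter-witness (untouched? p single? P) (allFin k) (subst (0 <_) (sym s≡) (s≤s z≤n))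
  ... | i , single , ¬τ with surj i
  ...   | v , refl = let live′ , s≡′ , b≡ = insert-single {v = v} live ¬τ single in
    v , (λ v∈P → ¬τ (v , v∈P , refl)) ,
    inj₂ (t , live′ , cong₂ (value t) (suc-injective (trans (sym s≡) s≡′)) b≡)
  realise-option {t} {P} live (takeBig b≡ refl)
    with filter-witness (untouched? p big? P) (allFin k) (subst (0 <_) (sym b≡) (s≤s z≤n))
  ... | i , big , ¬τ with surj i
  ...   | v , refl = let live′ , s≡ , b≡′ = insert-big {v = v} live ¬τ big in
    v , (λ v∈P → ¬τ (v , v∈P , refl)) ,
    inj₂ (true , live′ , cong₂ (value true) s≡ (suc-injective (trans (sym b≡) b≡′)))

  nimGEN-live : ∀ {t P} → Live t P → NimGEN E P (positionValue t P)
  nimGEN-live = nimGEN-certified E Live positionValue avoid attain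
    where
    avoid : ∀ {t P v} → Live t P → v ∉ P →
            ∃[ h ] LiveCertified (⁅ v ⁆ ∪ P) h × h ≢ positionValue t P
    avoid live v∉P = let h , c , o = move-option live v∉P in h , c , option≢value o

    attained : ∀ {t P h} → Live t P → Option t (untouchedSingles P) (untouchedBigs P) h →
               ¬ Generating E P × ∃[ v ] v ∉ P × LiveCertified (⁅ v ⁆ ∪ P) h
    attained live o = let v , v∉P , c = realise-option live o in
                      live⇒¬generating live v∉P , v , v∉P , c

    attain : ∀ {t P h} → Live t P → h < positionValue t P →
             ¬ Generating E P × ∃[ v ] v ∉ P × LiveCertified (⁅ v ⁆ ∪ P) h
    attain {true}  live h< = attained live (below-touched-value⇒option h<)
    attain {false} live@(_ , ¬τ-big) h< = attained live (below-fresh-value⇒option 1≤bigs h<)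
      where
      1≤bigs = subst (1 ≤_) (sym (untouchedCount-all p big? ¬τ-big))
                     (≤-trans (s≤s z≤n) two-big)

  nothing-touched-by-∅ : ∀ {i} → ¬ Touched p ⊥ i
  nothing-touched-by-∅ (_ , u∈⊥ , _) = ∉⊥ u∈⊥

  nimGEN-empty : NimGEN E ⊥ (value false (sigma p) (lambda p))
  nimGEN-empty =
    subst (NimGEN E ⊥)
      (cong₂ (value false) (untouchedCount-all p single? (λ _ → nothing-touched-by-∅))
                           (untouchedCount-all p big?    (λ _ → nothing-touched-by-∅)))
      (nimGEN-live {false} ((λ u∈⊥ → contradiction u∈⊥ ∉⊥) , λ _ → nothing-touched-by-∅))

proposition7p20 : (n k : ℕ) (p : Fin n → Fin k) →
    2 ≤ k →
    (∀ (i : Fin k) → Σ (Fin n) (λ v → p v ≡ i)) →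
    2 ≤ lambda p →
    (lambda p % 2 ≡ 0 → NimGEN (MultipartiteAdj p) ⊥ (2 * (sigma p % 2))) ×
    (lambda p % 2 ≡ 1 → NimGEN (MultipartiteAdj p) ⊥ (sigma p % 2))
proposition7p20 n k p _ surj two-big =
  (λ even → subst (NimGEN (MultipartiteAdj p) ⊥) (value-fresh-even (sigma p) (lambda p) even) nim) ,
  (λ odd  → subst (NimGEN (MultipartiteAdj p) ⊥) (value-fresh-odd  (sigma p) (lambda p) odd)  nim)
  where
  nim : NimGEN (MultipartiteAdj p) ⊥ (value false (sigma p) (lambda p))
  nim = nimGEN-empty p surj two-big
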